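{- The map $\eta:S\to X$ is a bijection whose inverse is the restriction of $\gamma$ to $X$, and for any permutation $\sigma$ and any Cayley permutation $y$, $$S(\sigma)=\gamma\bigl(X[\sigma^{ -1}]\bigr)\quad\text{and}\quad\gamma\bigl(X[y]\bigr)=S\bigl(\gamma(y)\bigr).$$ In other words, $\eta$ maps the set $S(\sigma)$ of permutations avoiding $\sigma$ onto the set of elements of $X$ avoiding every element of $[\sigma^{ -1}]$.
   Context: A Cayley permutation of length $n\ge 0$ is a word $x=x(1)\cdots x(n)$ of positive integers in which every integer from $1$ to $\max(x)$ occurs; $S$ is the set of permutations (one-line notation), $\mathrm{id}_n=12\cdots n$, $\sigma^{ -1}$ is the inverse permutation. $x$ contains $y$ if some subsequence $x(i_1)\cdots x(i_k)$, $i_1<\cdots<i_k$, is order isomorphic to $y$ (same relative order and same equalities); otherwise $x$ avoids $y$. For a weakly increasing Cayley permutation $u$ and a Cayley permutation $v$ of the same length, the Burge transpose $(u,v)^T$ of the biword with columns $\binom{u(i)}{v(i)}$ is obtained by flipping each column and sorting the columns increasingly by top entry, ties broken by decreasing bottom entry; write $(u,v)^T=(\mathrm{sort}(v),\Gamma(u,v))$. Let $\gamma(x)=\Gamma(\mathrm{id}_n,x)$ for $x$ of length $n$. Write $x\sim y$ iff $\gamma(x)=\gamma(y)$, and $[y]$ for the class of $y$. For $\pi\in S_n$ and $i\in[n]$ let $J(i)=0$ if $\pi(i)=1$ and otherwise let $J(i)$ be the index with $\pi(J(i))=\pi(i)-1$. The sites of $\pi$ are $0,1,\dots,n$ (site $0$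 is before $\pi(1)$, site $i\ge1$ immediately after $\pi(i)$). Site $0$ is $\eta$-active; site $i\ge1$ is $\eta$-active iff $J(i)<i$ or ($i<n$ and $\pi(i)<\pi(i+1)$). Let $\tilde\upsilon(\pi)$ be the word with $\tilde\upsilon(\pi)(j)$ equal to the number of $\eta$-active sites among $0,1,\dots,j-1$ (so entries between the $k$-th and $(k+1)$-st active site get label $k$). Define $\eta(\pi)=\Gamma(\tilde\upsilon(\pi),\pi)$ and $X=\eta(S)$. For a Cayley permutation $y$, $X[y]$ is the set of elements of $X$ avoiding every element of $[y]$, and $S(\sigma)$ the set of permutations avoiding $\sigma$. -}

module Defs where

open import Data.Nat using (ℕ; zero; suc; _+_; _∸_; _≤_; _<_; _⊔_; _<ᵇ_; _≡ᵇ_; _≤ᵇ_)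
open import Data.Bool using (Bool; true; false; if_then_else_; _∧_; _∨_)
open import Data.List using (List; []; _∷_; map; length; upTo; zipWith; foldr)
open import Data.Nat.ListAction using (sum)
open import Data.List.Relation.Unary.All using (All)
open import Data.List.Membership.Propositional using (_∈_)
open import Data.List.Relation.Binary.Permutation.Propositional using (_↭_)
import Data.List.Relation.Binary.Sublist.Propositional as SL
open import Data.Product using (_×_; _,_; proj₁; proj₂; ∃)
open import Function.Bundles using (_⇔_)
open import Relation.Binary.PropositionalEquality using (_≡_)
open import Relation.Nullary using (¬_)

-- Words are lists of natural numbers; positions are 1-based in the paper.

-- 0-based lookup with default 0
at : List ℕ → ℕ → ℕ
at []       _       = 0
at (x ∷ xs) zero    = x
at (x ∷ xs) (suc i) = at xs i

_⟨_⟩ : List ℕ → ℕ → ℕ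
x ⟨ i ⟩ = at x (i ∸ 1)

range1 : ℕ → List ℕ
range1 n = map suc (upTo n)

idn : ℕ → List ℕ
idn = range1

maxW : List ℕ → ℕ
maxW = foldr _⊔_ 0

IsCayley : List ℕ → Set
IsCayley x = All (1 ≤_) x × (∀ k → 1 ≤ k → k ≤ maxW x → k ∈ x)

IsPerm : List ℕ → Set
IsPerm π = π ↭ idn (length π)

OrderIso : List ℕ → List ℕ → Set
OrderIso s y = length s ≡ length y ×
  (∀ i j → i < length s → j < length s →
     ((at s i < at s j) ⇔ (at y i < at y j)) × ((at s i ≡ at s j) ⇔ (at y i ≡ at y j)))

Contains : List ℕ → List ℕ → Set
Contains x y = ∃ λ s → (s SL.⊆ x) × OrderIso s y

Avoids : List ℕ → List ℕ → Set
Avoids x y = ¬ Contains x y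

-- 1-based position of first occurrence of v in x (0 if absent)
indexOf : ℕ → List ℕ → ℕ
indexOf v []       = 0
indexOf v (x ∷ xs) = if v ≡ᵇ x then 1 else (if indexOf v xs ≡ᵇ 0 then 0 else suc (indexOf v xs))

inv : List ℕ → List ℕ
inv σ = map (λ k → indexOf k σ) (range1 (length σ))

-- Burge transpose. Columns are pairs (top , bottom).
-- Order: increasing top entry, ties broken by decreasing bottom entry.
colLe : ℕ × ℕ → ℕ × ℕ → Bool
colLe (a , b) (c , d) = (a <ᵇ c) ∨ ((a ≡ᵇ c) ∧ (d ≤ᵇ b))

insertCol : ℕ × ℕ → List (ℕ × ℕ) → List (ℕ × ℕ)
insertCol p []       = p ∷ []
insertCol p (q ∷ qs) = if colLe p q then p ∷ q ∷ qs else q ∷ insertCol p qs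

sortCols : List (ℕ × ℕ) → List (ℕ × ℕ)
sortCols = foldr insertCol []

-- (u,v)^T = (sort v , Γ(u,v)): flip each column (u(i),v(i)) to (v(i),u(i)), sort, take bottom row
Γ : List ℕ → List ℕ → List ℕ
Γ u v = map proj₂ (sortCols (zipWith (λ a b → (b , a)) u v))

γ : List ℕ → List ℕ
γ x = Γ (idn (length x)) x

J : List ℕ → ℕ → ℕ
J π i = if π ⟨ i ⟩ ≡ᵇ 1 then 0 else indexOf (π ⟨ i ⟩ ∸ 1) π

activeSite : List ℕ → ℕ → Bool
activeSite π i = (J π i <ᵇ i) ∨ ((i <ᵇ length π) ∧ (π ⟨ i ⟩ <ᵇ π ⟨ suc i ⟩))

-- number of η-active sites among 0,1,...,j-1 (site 0 always active)
activeCount : List ℕ → ℕ → ℕ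
activeCount π j = 1 + sum (map (λ i → if activeSite π i then 1 else 0) (range1 (j ∸ 1)))

υ̃ : List ℕ → List ℕ
υ̃ π = map (activeCount π) (range1 (length π))

η : List ℕ → List ℕ
η π = Γ (υ̃ π) π

InX : List ℕ → Set
InX x = ∃ λ π → IsPerm π × η π ≡ x

InClass : List ℕ → List ℕ → Set
InClass y z = IsCayley z × γ z ≡ γ y

InXAvoid : List ℕ → List ℕ → Set
InXAvoid y x = InX x × (∀ z → InClass y z → Avoids x z)

InSAvoid : List ℕ → List ℕ → Set
InSAvoid σ π = IsPerm π × Avoids π σ

InImageγ : (List ℕ → Set) → List ℕ → Set
InImageγ A π = ∃ λ x → A x × γ x ≡ π

-- Sorting the columns (x(i), i) in the Burge order and reading off the bottom row, γ lists the
-- positions of x by increasing value (equal values right to left). For a permutation this is the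
-- inverse, so γ(σ⁻¹) = σ and γ is injective on permutations. In η π = Γ(υ̃ π, π) every inactive
-- site i < n is a descent, so π decreases inside each block of equal labels: the columns
-- (υ̃ π (i), π(i)) are already in Burge order, whence γ(η π) = π.
-- Subsequences of x are sublists of its columns, and sorting commutes with passing to sublists of a
-- duplicate-free list. So an occurrence of z in x yields one of γ z in γ x, and conversely an
-- occurrence of γ y in γ x comes from a subsequence s of x with γ s order isomorphic, hence equal,
-- to γ y; the standardization of s then lies in [y]. Hence γ(X[y]) = S(γ y), and y = σ⁻¹ gives
-- S(σ) = γ(X[σ⁻¹]).

module Submission where

open import Defs
open import Data.Bool using (true; false; T; _∧_; _∨_; if_then_else_)
open import Data.Bool.Properties using (T-∧; T-∨; T-≡)
open import Data.Empty using (⊥-elim)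
open import Data.List using (List; []; _∷_; [_]; map; length; upTo; applyUpTo; zipWith; filter; _++_)
open import Data.List.Properties
  using (map-applyUpTo; map-upTo; length-applyUpTo; length-map; map-∘; map-id; map-++; upTo-∷ʳ;
         filter-accept; filter-reject; filter-none; foldr-forcesᵇ; foldr-preservesᵇ)
open import Data.List.Membership.Propositional using (_∈_)
open import Data.List.Membership.Propositional.Properties using (∈-applyUpTo⁻; ∈-upTo⁺; ∈-map⁺; ∈-filter⁺; ∈-filter⁻)
open import Data.List.Relation.Unary.All using (All; []; _∷_)
import Data.List.Relation.Unary.All as All
import Data.List.Relation.Unary.All.Properties as All
open import Data.List.Relation.Unary.Any using (here; there)
open import Data.List.Relation.Unary.AllPairs using (AllPairs; []; _∷_)
import Data.List.Relation.Unary.AllPairs as AllPairs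
import Data.List.Relation.Unary.AllPairs.Properties as AllPairs
open import Data.List.Relation.Unary.Linked using ([]; [-]; _∷_)
open import Data.List.Relation.Unary.Unique.Propositional using (Unique)
import Data.List.Relation.Unary.Unique.Propositional.Properties as Unique
open import Data.List.Relation.Binary.Permutation.Propositional using (_↭_; ↭-sym; ↭-trans; ↭⇒↭ₛ)
open import Data.List.Relation.Binary.Permutation.Propositional.Properties using (∈-resp-↭; ↭-length; filter-↭)
import Data.List.Relation.Binary.Permutation.Propositional.Properties as Perm
import Data.List.Relation.Binary.Permutation.Setoid.Properties as Permₛ
open import Data.List.Relation.Binary.Pointwise using (Pointwise-≡⇒≡)
open import Data.List.Relation.Binary.Sublist.Propositional using (_⊆_; []; _∷_; _∷ʳ_; lookup)
open import Data.List.Relation.Binary.Sublist.Propositional.Properties using (filter-⊆) renaming (map⁺ to ⊆-map⁺)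
open import Data.Nat
open import Data.Nat.Properties
open import Data.Nat.ListAction using (sum)
open import Data.Nat.ListAction.Properties using (sum-++)
open import Data.Product using (_×_; _,_; proj₁; proj₂; ∃)
import Data.Product.Properties as Product
open import Data.Sum using (_⊎_; inj₁; inj₂)
open import Function using (_∘_; id)
open import Function.Bundles using (_⇔_; mk⇔; Equivalence)
import Function.Properties.Equivalence as ⇔
open import Relation.Binary.Bundles using (DecTotalOrder)
open import Relation.Binary.Definitions using (tri<; tri≈; tri>)
open import Relation.Binary.PropositionalEquality hiding ([_])
open import Relation.Nullary using (¬_; Dec; yes; no)
open import Relation.Nullary.Decidable using (T?)
open import Relation.Nullary.Reflects using (fromEquivalence; T-reflects-elim)

open Equivalence using (to; from)

applyUpTo-cong : ∀ {A : Set} {f g : ℕ → A} n → (∀ {i} → i < n → f i ≡ g i) → applyUpTo f n ≡ applyUpTo g n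
applyUpTo-cong zero _ = refl
applyUpTo-cong (suc n) f≗g = cong₂ _∷_ (f≗g z<s) (applyUpTo-cong n (f≗g ∘ s<s))

at-applyUpTo : ∀ (f : ℕ → ℕ) n {i} → i < n → at (applyUpTo f n) i ≡ f i
at-applyUpTo f (suc n) {zero} _ = refl
at-applyUpTo f (suc n) {suc i} (s<s i<n) = at-applyUpTo (f ∘ suc) n i<n

applyUpTo-at : ∀ l → applyUpTo (at l) (length l) ≡ l
applyUpTo-at [] = refl
applyUpTo-at (x ∷ l) = cong (x ∷_) (applyUpTo-at l)

map-applyUpTo-at : ∀ {A : Set} (F : ℕ → A) l → map F l ≡ applyUpTo (F ∘ at l) (length l)
map-applyUpTo-at F l = trans (cong (map F) (sym (applyUpTo-at l))) (map-applyUpTo (at l) F (length l))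

zipWith-applyUpTo : ∀ {A : Set} (h : ℕ → ℕ → A) (f : ℕ → ℕ) l →
  zipWith h (applyUpTo f (length l)) l ≡ applyUpTo (λ i → h (f i) (at l i)) (length l)
zipWith-applyUpTo h f [] = refl
zipWith-applyUpTo h f (x ∷ l) = cong (h (f 0) x ∷_) (zipWith-applyUpTo h (f ∘ suc) l)

at-map : ∀ (F : ℕ → ℕ) l {i} → i < length l → at (map F l) i ≡ F (at l i)
at-map F (x ∷ l) {zero} _ = refl
at-map F (x ∷ l) {suc i} (s<s i<n) = at-map F l i<n

at-∈ : ∀ l {i} → i < length l → at l i ∈ l
at-∈ (x ∷ l) {zero} _ = here refl
at-∈ (x ∷ l) {suc i} (s<s i<n) = there (at-∈ l i<n)

∈⇒at : ∀ {v} l → v ∈ l → ∃ λ i → i < length l × at l i ≡ v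
∈⇒at (x ∷ l) (here refl) = 0 , z<s , refl
∈⇒at (x ∷ l) (there v∈l) = let (i , i<n , eq) = ∈⇒at l v∈l in suc i , s<s i<n , eq

AllPairs-at : ∀ {R : ℕ → ℕ → Set} {l} → AllPairs R l → ∀ {i j} → i < j → j < length l → R (at l i) (at l j)
AllPairs-at {l = x ∷ l} (x~l ∷ _) {zero} {suc j} _ (s<s j<n) = All.lookup x~l (at-∈ l j<n)
AllPairs-at {l = x ∷ l} (_ ∷ l!) {suc i} {suc j} (s<s i<j) (s<s j<n) = AllPairs-at l! i<j j<n

AllPairs-⊆ : ∀ {A : Set} {R : A → A → Set} {xs ys} → xs ⊆ ys → AllPairs R ys → AllPairs R xs
AllPairs-⊆ [] [] = []
AllPairs-⊆ (y ∷ʳ xs⊆ys) (_ ∷ ys!) = AllPairs-⊆ xs⊆ys ys!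
AllPairs-⊆ (refl ∷ xs⊆ys) (y~ys ∷ ys!) = All.anti-mono (lookup xs⊆ys) y~ys ∷ AllPairs-⊆ xs⊆ys ys!

⊆-map-lift : ∀ {A B : Set} (f : A → B) {t : List B} {S : List A} → t ⊆ map f S →
  ∃ λ T → T ⊆ S × map f T ≡ t
⊆-map-lift f {S = []} [] = [] , [] , refl
⊆-map-lift f {S = y ∷ S} (_ ∷ʳ t⊆) =
  let (T , T⊆S , eq) = ⊆-map-lift f t⊆ in T , y ∷ʳ T⊆S , eq
⊆-map-lift f {S = y ∷ S} (refl ∷ t⊆) =
  let (T , T⊆S , eq) = ⊆-map-lift f t⊆ in y ∷ T , refl ∷ T⊆S , cong (f y ∷_) eq

idn≡applyUpTo : ∀ n → idn n ≡ applyUpTo suc n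
idn≡applyUpTo = map-upTo suc

length-idn : ∀ n → length (idn n) ≡ n
length-idn n = trans (cong length (idn≡applyUpTo n)) (length-applyUpTo suc n)

∈-idn⁻ : ∀ {v} n → v ∈ idn n → ∃ λ i → i < n × v ≡ suc i
∈-idn⁻ n v∈ = ∈-applyUpTo⁻ suc (subst (_ ∈_) (idn≡applyUpTo n) v∈)

idn-increasing : ∀ n → AllPairs _<_ (idn n)
idn-increasing n = subst (AllPairs _<_) (sym (idn≡applyUpTo n)) (AllPairs.applyUpTo⁺₁ suc n (λ i<j _ → s<s i<j))

idn-unique : ∀ n → Unique (idn n)
idn-unique n = AllPairs.map <⇒≢ (idn-increasing n)

≡ᵇ-refl : ∀ n → (n ≡ᵇ n) ≡ true
≡ᵇ-refl n = to T-≡ (≡⇒≡ᵇ n n refl)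

≢⇒≡ᵇ≡false : ∀ {m n} → m ≢ n → (m ≡ᵇ n) ≡ false
≢⇒≡ᵇ≡false {m} {n} m≢n with m ≡ᵇ n in eq
... | true = ⊥-elim (m≢n (≡ᵇ⇒≡ m n (subst T (sym eq) _)))
... | false = refl

indexOf-at : ∀ l → Unique l → ∀ {j} → j < length l → indexOf (at l j) l ≡ suc j
indexOf-at (x ∷ l) _ {zero} _ rewrite ≡ᵇ-refl x = refl
indexOf-at (x ∷ l) (x∉l ∷ l!) {suc j} (s<s j<n)
  rewrite ≢⇒≡ᵇ≡false (λ e → All.lookup x∉l (at-∈ l j<n) (sym e)) | indexOf-at l l! j<n = refl

perm-unique : ∀ π → IsPerm π → Unique π
perm-unique π π↭ = Permₛ.Unique-resp-↭ (setoid ℕ) (↭⇒↭ₛ (↭-sym π↭)) (idn-unique (length π))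

applyUpTo-indexOf : ∀ {A : Set} π → IsPerm π → (F : ℕ → ℕ → A) →
  applyUpTo (λ j → F (at π j) (suc j)) (length π) ≡ map (λ v → F v (indexOf v π)) π
applyUpTo-indexOf π π↭ F = trans
  (applyUpTo-cong (length π) (λ j<n → cong (F _) (sym (indexOf-at π (perm-unique π π↭) j<n))))
  (sym (map-applyUpTo-at _ π))

StrictlyIncreasingOn : (ℕ → Set) → (ℕ → ℕ) → Set
StrictlyIncreasingOn P h = ∀ {a b} → P a → P b → a < b → h a < h b

at-increasing : ∀ {l} → AllPairs _<_ l → StrictlyIncreasingOn (_< length l) (at l)
at-increasing l↗ _ j<n i<j = AllPairs-at l↗ i<j j<n

module _ {P : ℕ → Set} {h : ℕ → ℕ} (mono : StrictlyIncreasingOn P h) where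

  strictMono-<⇔ : ∀ {a b} → P a → P b → h a < h b ⇔ a < b
  strictMono-<⇔ {a} {b} pa pb = mk⇔ reflect (mono pa pb)
    where
    reflect : h a < h b → a < b
    reflect ha<hb with <-cmp a b
    ... | tri< a<b _ _ = a<b
    ... | tri≈ _ refl _ = ⊥-elim (<-irrefl refl ha<hb)
    ... | tri> _ _ b<a = ⊥-elim (<-asym ha<hb (mono pb pa b<a))

  strictMono-≡⇔ : ∀ {a b} → P a → P b → h a ≡ h b ⇔ a ≡ b
  strictMono-≡⇔ {a} {b} pa pb = mk⇔ reflect (cong h)
    where
    reflect : h a ≡ h b → a ≡ b
    reflect ha≡hb with <-cmp a b
    ... | tri< a<b _ _ = ⊥-elim (<-irrefl ha≡hb (mono pa pb a<b))
    ... | tri≈ _ a≡b _ = a≡b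
    ... | tri> _ _ b<a = ⊥-elim (<-irrefl (sym ha≡hb) (mono pb pa b<a))

  strictMono-≤⇔ : ∀ {a b} → P a → P b → h a ≤ h b ⇔ a ≤ b
  strictMono-≤⇔ pa pb = mk⇔ (λ ha≤hb → ≮⇒≥ λ b<a → <⇒≱ (mono pb pa b<a) ha≤hb)
                            (λ a≤b → ≮⇒≥ λ hb<ha → <⇒≱ (to (strictMono-<⇔ pb pa) hb<ha) a≤b)

  map-orderIso : ∀ w → (∀ {a} → a ∈ w → P a) → OrderIso (map h w) w
  map-orderIso w inP = length-map h w , λ i j i< j< →
    pointwise (subst (i <_) (length-map h w) i<) (subst (j <_) (length-map h w) j<)
    where
    pointwise : ∀ {i j} → i < length w → j < length w →
      (at (map h w) i < at (map h w) j ⇔ at w i < at w j) × (at (map h w) i ≡ at (map h w) j ⇔ at w i ≡ at w j)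
    pointwise i<n j<n rewrite at-map h w i<n | at-map h w j<n =
      strictMono-<⇔ (inP (at-∈ w i<n)) (inP (at-∈ w j<n)) , strictMono-≡⇔ (inP (at-∈ w i<n)) (inP (at-∈ w j<n))

orderIso-sym : ∀ a b → OrderIso a b → OrderIso b a
orderIso-sym a b (a≡b , iso) = sym a≡b , λ i j i< j< →
  let (lt , eq) = iso i j (subst (i <_) (sym a≡b) i<) (subst (j <_) (sym a≡b) j<) in ⇔.sym lt , ⇔.sym eq

-- The Burge order on columns

Col : Set
Col = ℕ × ℕ

T-injective : ∀ {b b′} → T b ⇔ T b′ → b ≡ b′
T-injective e = T-reflects-elim (fromEquivalence (to e) (from e))

bool-cong : ∀ {b b′} {A A′ : Set} → T b ⇔ A → T b′ ⇔ A′ → A ⇔ A′ → b ≡ b′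
bool-cong r r′ e = T-injective (⇔.trans r (⇔.trans e (⇔.sym r′)))

<ᵇ-cong : ∀ {m n m′ n′} → m < n ⇔ m′ < n′ → (m <ᵇ n) ≡ (m′ <ᵇ n′)
<ᵇ-cong {m} {n} {m′} {n′} = bool-cong (mk⇔ (<ᵇ⇒< m n) <⇒<ᵇ) (mk⇔ (<ᵇ⇒< m′ n′) <⇒<ᵇ)

≤ᵇ-cong : ∀ {m n m′ n′} → m ≤ n ⇔ m′ ≤ n′ → (m ≤ᵇ n) ≡ (m′ ≤ᵇ n′)
≤ᵇ-cong {m} {n} {m′} {n′} = bool-cong (mk⇔ (≤ᵇ⇒≤ m n) ≤⇒≤ᵇ) (mk⇔ (≤ᵇ⇒≤ m′ n′) ≤⇒≤ᵇ)

≡ᵇ-cong : ∀ {m n m′ n′} → m ≡ n ⇔ m′ ≡ n′ → (m ≡ᵇ n) ≡ (m′ ≡ᵇ n′)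
≡ᵇ-cong {m} {n} {m′} {n′} = bool-cong (mk⇔ (≡ᵇ⇒≡ m n) (≡⇒≡ᵇ m n)) (mk⇔ (≡ᵇ⇒≡ m′ n′) (≡⇒≡ᵇ m′ n′))

colLe-cong : ∀ {a b c d a′ b′ c′ d′} →
  a < c ⇔ a′ < c′ → a ≡ c ⇔ a′ ≡ c′ → d ≤ b ⇔ d′ ≤ b′ →
  colLe (a , b) (c , d) ≡ colLe (a′ , b′) (c′ , d′)
colLe-cong lt eq le = cong₂ _∨_ (<ᵇ-cong lt) (cong₂ _∧_ (≡ᵇ-cong eq) (≤ᵇ-cong le))

_≼_ : Col → Col → Set
p ≼ q = T (colLe p q)

ColLe : Col → Col → Set
ColLe (a , b) (c , d) = a < c ⊎ (a ≡ c × d ≤ b)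

≼⇒ColLe : ∀ p q → p ≼ q → ColLe p q
≼⇒ColLe (a , b) (c , d) h with to T-∨ h
... | inj₁ a<c = inj₁ (<ᵇ⇒< a c a<c)
... | inj₂ a=c∧d≤b = let (a=c , d≤b) = to T-∧ a=c∧d≤b in inj₂ (≡ᵇ⇒≡ a c a=c , ≤ᵇ⇒≤ d b d≤b)

ColLe⇒≼ : ∀ p q → ColLe p q → p ≼ q
ColLe⇒≼ (a , b) (c , d) (inj₁ a<c) = from T-∨ (inj₁ (<⇒<ᵇ a<c))
ColLe⇒≼ (a , b) (c , d) (inj₂ (a=c , d≤b)) = from T-∨ (inj₂ (from T-∧ (≡⇒≡ᵇ a c a=c , ≤⇒≤ᵇ d≤b)))

≼-reflexive : ∀ {p q} → p ≡ q → p ≼ q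
≼-reflexive {p} refl = ColLe⇒≼ p p (inj₂ (refl , ≤-refl))

≼-trans : ∀ {p q r} → p ≼ q → q ≼ r → p ≼ r
≼-trans {p} {q} {r} p≼q q≼r = ColLe⇒≼ p r (trans′ (≼⇒ColLe p q p≼q) (≼⇒ColLe q r q≼r))
  where
  trans′ : ColLe p q → ColLe q r → ColLe p r
  trans′ (inj₁ a<c) (inj₁ c<e) = inj₁ (<-trans a<c c<e)
  trans′ (inj₁ a<c) (inj₂ (refl , _)) = inj₁ a<c
  trans′ (inj₂ (refl , _)) (inj₁ c<e) = inj₁ c<e
  trans′ (inj₂ (refl , d≤b)) (inj₂ (refl , f≤d)) = inj₂ (refl , ≤-trans f≤d d≤b)

≼-antisym : ∀ {p q} → p ≼ q → q ≼ p → p ≡ q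
≼-antisym {p} {q} p≼q q≼p = antisym′ (≼⇒ColLe p q p≼q) (≼⇒ColLe q p q≼p)
  where
  antisym′ : ColLe p q → ColLe q p → p ≡ q
  antisym′ (inj₁ a<c) (inj₁ c<a) = ⊥-elim (<-asym a<c c<a)
  antisym′ (inj₁ a<c) (inj₂ (refl , _)) = ⊥-elim (<-irrefl refl a<c)
  antisym′ (inj₂ (refl , _)) (inj₁ c<a) = ⊥-elim (<-irrefl refl c<a)
  antisym′ (inj₂ (refl , d≤b)) (inj₂ (_ , b≤d)) = cong (_ ,_) (≤-antisym b≤d d≤b)

≼-total : ∀ p q → p ≼ q ⊎ q ≼ p
≼-total (a , b) (c , d) with <-cmp a c
... | tri< a<c _ _ = inj₁ (ColLe⇒≼ (a , b) (c , d) (inj₁ a<c))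
... | tri> _ _ c<a = inj₂ (ColLe⇒≼ (c , d) (a , b) (inj₁ c<a))
... | tri≈ _ refl _ with ≤-total b d
...   | inj₁ b≤d = inj₂ (ColLe⇒≼ (c , d) (a , b) (inj₂ (refl , b≤d)))
...   | inj₂ d≤b = inj₁ (ColLe⇒≼ (a , b) (c , d) (inj₂ (refl , d≤b)))

colOrder : DecTotalOrder _ _ _
colOrder = record
  { Carrier = Col ; _≈_ = _≡_ ; _≤_ = _≼_
  ; isDecTotalOrder = record
    { isTotalOrder = record
      { isPartialOrder = record
        { isPreorder = record
          { isEquivalence = isEquivalence
          ; reflexive = ≼-reflexive
          ; trans = λ {p} {q} {r} → ≼-trans {p} {q} {r} }
        ; antisym = λ {p} {q} → ≼-antisym {p} {q} }
      ; total = ≼-total }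
    ; _≟_ = Product.≡-dec _≟_ _≟_
    ; _≤?_ = λ p q → T? (colLe p q) } }  -- so InsertionSort.insert branches on colLe itself

-- Sorting columns

open DecTotalOrder colOrder using (totalOrder)
open import Data.List.Relation.Unary.Sorted.TotalOrder totalOrder using (Sorted)
import Data.List.Relation.Unary.Sorted.TotalOrder.Properties as Sorted
import Data.List.Sort.InsertionSort.Base colOrder as InsertionSort
import Data.List.Sort.InsertionSort.Properties colOrder as InsertionSortₚ
open import Data.List.Membership.DecPropositional (Product.≡-dec _≟_ _≟_) using (_∈?_)
open import Data.List.Membership.DecPropositional _≟_ using () renaming (_∈?_ to _∈ℕ?_)

insertCol≡insert : ∀ p qs → insertCol p qs ≡ InsertionSort.insert p qs
insertCol≡insert p [] = refl
insertCol≡insert p (q ∷ qs) with colLe p q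
... | true = refl
... | false = cong (q ∷_) (insertCol≡insert p qs)

sortCols≡sort : ∀ l → sortCols l ≡ InsertionSort.sort l
sortCols≡sort [] = refl
sortCols≡sort (p ∷ l) rewrite sortCols≡sort l = insertCol≡insert p (InsertionSort.sort l)

sortCols-↭ : ∀ l → sortCols l ↭ l
sortCols-↭ l rewrite sortCols≡sort l = InsertionSortₚ.sort-↭ l

sortCols-↗ : ∀ l → Sorted (sortCols l)
sortCols-↗ l rewrite sortCols≡sort l = InsertionSortₚ.sort-↗ l

↗↭↗⇒≡ : ∀ {l l′} → Sorted l → Sorted l′ → l ↭ l′ → l ≡ l′
↗↭↗⇒≡ l↗ l′↗ l↭l′ = Pointwise-≡⇒≡ (Sorted.↗↭↗⇒≋ totalOrder l↗ l′↗ (↭⇒↭ₛ l↭l′))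

sortCols-unique : ∀ {l l′} → l ↭ l′ → Sorted l′ → sortCols l ≡ l′
sortCols-unique {l} l↭l′ l′↗ = ↗↭↗⇒≡ (sortCols-↗ l) l′↗ (↭-trans (sortCols-↭ l) l↭l′)

applyUpTo-sorted : ∀ (f : ℕ → Col) n → (∀ {i} → suc i < n → f i ≼ f (suc i)) → Sorted (applyUpTo f n)
applyUpTo-sorted f zero _ = []
applyUpTo-sorted f (suc zero) _ = [-]
applyUpTo-sorted f (suc (suc n)) adj = adj (s<s z<s) ∷ applyUpTo-sorted (f ∘ suc) (suc n) (adj ∘ s<s)

sorted-byTop : ∀ (g : ℕ → ℕ) n → Sorted (map (λ v → (v , g v)) (idn n))
sorted-byTop g n = subst Sorted (sym (trans (cong (map _) (idn≡applyUpTo n)) (map-applyUpTo suc _ n)))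
  (applyUpTo-sorted _ n (λ {i} _ → ColLe⇒≼ (suc i , g (suc i)) (suc (suc i) , g (suc (suc i))) (inj₁ ≤-refl)))

insertCol-map : ∀ (f : Col → Col) p qs → (∀ {q} → q ∈ qs → colLe (f p) (f q) ≡ colLe p q) →
  insertCol (f p) (map f qs) ≡ map f (insertCol p qs)
insertCol-map f p [] _ = refl
insertCol-map f p (q ∷ qs) pres rewrite pres (here refl) with colLe p q
... | true = refl
... | false = cong (f q ∷_) (insertCol-map f p qs (pres ∘ there))

sortCols-map : ∀ (f : Col → Col) l → (∀ {p q} → p ∈ l → q ∈ l → colLe (f p) (f q) ≡ colLe p q) →
  sortCols (map f l) ≡ map f (sortCols l)
sortCols-map f [] _ = refl
sortCols-map f (p ∷ l) pres rewrite sortCols-map f l (λ p∈l q∈l → pres (there p∈l) (there q∈l)) =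
  insertCol-map f p (sortCols l) (λ q∈ → pres (here refl) (there (∈-resp-↭ (sortCols-↭ l) q∈)))

sortCols-filter : ∀ {P : Col → Set} (P? : ∀ p → Dec (P p)) l → sortCols (filter P? l) ≡ filter P? (sortCols l)
sortCols-filter P? l = sortCols-unique (filter-↭ P? (↭-sym (sortCols-↭ l))) (Sorted.filter⁺ totalOrder P? (sortCols-↗ l))

filter-∈-∷ : ∀ {y : Col} {T} S → All (y ≢_) S → filter (_∈? (y ∷ T)) S ≡ filter (_∈? T) S
filter-∈-∷ [] [] = refl
filter-∈-∷ {y} {T} (x ∷ S) (y≢x ∷ y∉S) = by-cases (x ∈? T)
  where
  by-cases : Dec (x ∈ T) → filter (_∈? (y ∷ T)) (x ∷ S) ≡ filter (_∈? T) (x ∷ S)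
  by-cases (yes x∈T) = begin
    filter (_∈? (y ∷ T)) (x ∷ S) ≡⟨ filter-accept (_∈? (y ∷ T)) (there x∈T) ⟩
    x ∷ filter (_∈? (y ∷ T)) S   ≡⟨ cong (x ∷_) (filter-∈-∷ S y∉S) ⟩
    x ∷ filter (_∈? T) S         ≡⟨ filter-accept (_∈? T) x∈T ⟨
    filter (_∈? T) (x ∷ S)       ∎
    where open ≡-Reasoning
  by-cases (no x∉T) = begin
    filter (_∈? (y ∷ T)) (x ∷ S) ≡⟨ filter-reject (_∈? (y ∷ T)) x∉y∷T ⟩
    filter (_∈? (y ∷ T)) S       ≡⟨ filter-∈-∷ S y∉S ⟩
    filter (_∈? T) S             ≡⟨ filter-reject (_∈? T) x∉T ⟨
    filter (_∈? T) (x ∷ S)       ∎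
    where
    open ≡-Reasoning
    x∉y∷T : ¬ x ∈ y ∷ T
    x∉y∷T (here x≡y) = y≢x (sym x≡y)
    x∉y∷T (there x∈T) = x∉T x∈T

filter-∈-sublist : ∀ {T S : List Col} → Unique S → T ⊆ S → filter (_∈? T) S ≡ T
filter-∈-sublist [] [] = refl
filter-∈-sublist {T} (y∉S ∷ S!) (y ∷ʳ T⊆S) =
  trans (filter-reject (_∈? T) (λ y∈T → All.lookup y∉S (lookup T⊆S y∈T) refl)) (filter-∈-sublist S! T⊆S)
filter-∈-sublist {y ∷ T} {y ∷ S} (y∉S ∷ S!) (refl ∷ T⊆S) =
  trans (filter-accept (_∈? (y ∷ T)) (here refl))
        (cong (y ∷_) (trans (filter-∈-∷ S y∉S) (filter-∈-sublist S! T⊆S)))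

Unique-resp-↭ : ∀ {S S′ : List Col} → S ↭ S′ → Unique S → Unique S′
Unique-resp-↭ S↭S′ = Permₛ.Unique-resp-↭ (setoid Col) (↭⇒↭ₛ S↭S′)

sortCols-⊆ : ∀ {E L : List Col} → Unique L → E ⊆ L → sortCols E ⊆ sortCols L
sortCols-⊆ {E} {L} L! E⊆L = subst (_⊆ sortCols L) sortE (filter-⊆ (_∈? E) (sortCols L))
  where
  sortE : filter (_∈? E) (sortCols L) ≡ sortCols E
  sortE = trans (sym (sortCols-filter (_∈? E) L)) (cong sortCols (filter-∈-sublist L! E⊆L))

sortCols-filter-sublist : ∀ {T L : List Col} → Unique L → T ⊆ sortCols L → sortCols (filter (_∈? T) L) ≡ T
sortCols-filter-sublist {T} {L} L! T⊆ =
  trans (sortCols-filter (_∈? T) L) (filter-∈-sublist (Unique-resp-↭ (↭-sym (sortCols-↭ L)) L!) T⊆)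

-- The map γ

columns : List ℕ → List Col
columns x = zipWith (λ a b → (b , a)) (idn (length x)) x

columns-applyUpTo : ∀ x → columns x ≡ applyUpTo (λ i → (at x i , suc i)) (length x)
columns-applyUpTo x = trans (cong (λ l → zipWith (λ a b → (b , a)) l x) (idn≡applyUpTo (length x)))
  (zipWith-applyUpTo (λ a b → (b , a)) suc x)

map-proj₁-columns : ∀ x → map proj₁ (columns x) ≡ x
map-proj₁-columns x = trans (cong (map proj₁) (columns-applyUpTo x))
  (trans (map-applyUpTo _ proj₁ (length x)) (applyUpTo-at x))

map-proj₂-columns : ∀ x → map proj₂ (columns x) ≡ idn (length x)
map-proj₂-columns x = trans (cong (map proj₂) (columns-applyUpTo x))
  (trans (map-applyUpTo _ proj₂ (length x)) (sym (idn≡applyUpTo (length x))))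

columns-unique : ∀ x → Unique (columns x)
columns-unique x = Unique.map⁻ (subst Unique (sym (map-proj₂-columns x)) (idn-unique (length x)))

γ-↭-idn : ∀ x → γ x ↭ idn (length x)
γ-↭-idn x = subst (γ x ↭_) (map-proj₂-columns x) (Perm.map⁺ proj₂ (sortCols-↭ (columns x)))

length-γ : ∀ x → length (γ x) ≡ length x
length-γ x = trans (↭-length (γ-↭-idn x)) (length-idn (length x))

γ-isPerm : ∀ x → IsPerm (γ x)
γ-isPerm x = subst (λ n → γ x ↭ idn n) (sym (length-γ x)) (γ-↭-idn x)

sortCols-byPermTop : ∀ π → IsPerm π → (g : ℕ → ℕ) →
  sortCols (map (λ v → (v , g v)) π) ≡ map (λ v → (v , g v)) (idn (length π))
sortCols-byPermTop π π↭ g = sortCols-unique (Perm.map⁺ _ π↭) (sorted-byTop g (length π))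

γ-perm≡inv : ∀ π → IsPerm π → γ π ≡ inv π
γ-perm≡inv π π↭ = begin
  map proj₂ (sortCols (columns π))       ≡⟨ cong (map proj₂ ∘ sortCols) columns≡ ⟩
  map proj₂ (sortCols (map column π))    ≡⟨ cong (map proj₂) (sortCols-byPermTop π π↭ pos) ⟩
  map proj₂ (map column (idn (length π))) ≡⟨ map-∘ (idn (length π)) ⟨
  inv π                                  ∎
  where
  open ≡-Reasoning
  pos : ℕ → ℕ
  pos v = indexOf v π
  column : ℕ → Col
  column v = (v , pos v)
  columns≡ : columns π ≡ map column π
  columns≡ = trans (columns-applyUpTo π) (applyUpTo-indexOf π π↭ _,_)

columns-map-idn : ∀ (f : ℕ → ℕ) n → columns (map f (idn n)) ≡ map (λ v → (f v , v)) (idn n)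
columns-map-idn f n = begin
  columns (map f (idn n))                                       ≡⟨ columns-applyUpTo _ ⟩
  applyUpTo (λ i → (at fs i , suc i)) (length fs)               ≡⟨ cong (applyUpTo _) length≡ ⟩
  applyUpTo (λ i → (at fs i , suc i)) n                         ≡⟨ applyUpTo-cong n (λ i<n → cong (_, _) (at≡ i<n)) ⟩
  applyUpTo (column ∘ suc) n                                    ≡⟨ map-applyUpTo suc column n ⟨
  map column (applyUpTo suc n)                                  ≡⟨ cong (map column) (idn≡applyUpTo n) ⟨
  map column (idn n)                                            ∎
  where
  open ≡-Reasoning
  fs = map f (idn n)
  column : ℕ → Col
  column v = (f v , v)
  length≡ : length fs ≡ n
  length≡ = trans (length-map f (idn n)) (length-idn n)
  at≡ : ∀ {i} → i < n → at fs i ≡ f (suc i)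
  at≡ {i} i<n = trans (cong (λ l → at l i) (trans (cong (map f) (idn≡applyUpTo n)) (map-applyUpTo suc f n)))
                      (at-applyUpTo (f ∘ suc) n i<n)

γ-map-idn : ∀ π → IsPerm π → (f : ℕ → ℕ) → Sorted (map (λ v → (f v , v)) π) →
  γ (map f (idn (length π))) ≡ π
γ-map-idn π π↭ f sorted = begin
  map proj₂ (sortCols (columns (map f (idn n)))) ≡⟨ cong (map proj₂ ∘ sortCols) (columns-map-idn f n) ⟩
  map proj₂ (sortCols (map column (idn n)))      ≡⟨ cong (map proj₂) (sortCols-unique column-↭ sorted) ⟩
  map proj₂ (map column π)                       ≡⟨ map-∘ π ⟨
  map id π                                       ≡⟨ map-id π ⟩
  π                                              ∎
  where
  open ≡-Reasoning
  n = length π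
  column : ℕ → Col
  column v = (f v , v)
  column-↭ : map column (idn n) ↭ map column π
  column-↭ = Perm.map⁺ column (↭-sym π↭)

γ-inv : ∀ σ → IsPerm σ → γ (inv σ) ≡ σ
γ-inv σ σ↭ = γ-map-idn σ σ↭ (λ v → indexOf v σ)
  (subst Sorted (applyUpTo-indexOf σ σ↭ (λ v k → (k , v)))
    (applyUpTo-sorted _ (length σ) (λ {j} _ → ColLe⇒≼ (suc j , at σ j) (suc (suc j) , at σ (suc j)) (inj₁ ≤-refl))))

γ-injective : ∀ {a b} → IsPerm a → IsPerm b → γ a ≡ γ b → a ≡ b
γ-injective {a} {b} a↭ b↭ γa≡γb = begin
  a             ≡⟨ γ-inv a a↭ ⟨
  γ (inv a)     ≡⟨ cong γ (γ-perm≡inv a a↭) ⟨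
  γ (γ a)       ≡⟨ cong γ γa≡γb ⟩
  γ (γ b)       ≡⟨ cong γ (γ-perm≡inv b b↭) ⟩
  γ (inv b)     ≡⟨ γ-inv b b↭ ⟩
  b             ∎
  where open ≡-Reasoning

-- γ inverts η

activeCount-step : ∀ π j →
  activeCount π (suc (suc j)) ≡ activeCount π (suc j) + (if activeSite π (suc j) then 1 else 0)
activeCount-step π j = begin
  1 + sum (map act (map suc (upTo (suc j))))          ≡⟨ cong (λ l → 1 + sum (map act (map suc l))) (upTo-∷ʳ j) ⟨
  1 + sum (map act (map suc (upTo j ++ [ j ])))       ≡⟨ cong (λ l → 1 + sum (map act l)) (map-++ suc (upTo j) [ j ]) ⟩
  1 + sum (map act (range1 j ++ [ suc j ]))           ≡⟨ cong (λ l → 1 + sum l) (map-++ act (range1 j) [ suc j ]) ⟩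
  1 + sum (map act (range1 j) ++ [ act (suc j) ])     ≡⟨ cong (1 +_) (sum-++ (map act (range1 j)) [ act (suc j) ]) ⟩
  1 + (sum (map act (range1 j)) + (act (suc j) + 0))  ≡⟨ cong (λ a → 1 + (sum (map act (range1 j)) + a)) (+-identityʳ _) ⟩
  activeCount π (suc j) + act (suc j)                  ∎
  where
  open ≡-Reasoning
  act : ℕ → ℕ
  act i = if activeSite π i then 1 else 0

inactive⇒descent : ∀ π j → suc j < length π → activeSite π (suc j) ≡ false → at π (suc j) ≤ at π j
inactive⇒descent π j j+1<n inactive = ≮⇒≥ λ ascent →
  subst T inactive (from T-∨ (inj₂ (from T-∧ (<⇒<ᵇ j+1<n , <⇒<ᵇ ascent))))

η-columns-sorted : ∀ π → Sorted (applyUpTo (λ j → (activeCount π (suc j) , at π j)) (length π))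
η-columns-sorted π = applyUpTo-sorted _ (length π) adjacent
  where
  adjacent : ∀ {j} → suc j < length π →
    (activeCount π (suc j) , at π j) ≼ (activeCount π (suc (suc j)) , at π (suc j))
  adjacent {j} j+1<n = subst (λ c′ → (c , at π j) ≼ (c′ , at π (suc j)))
    (sym (activeCount-step π j)) (byActivity (activeSite π (suc j)) refl)
    where
    c = activeCount π (suc j)
    byActivity : ∀ b → activeSite π (suc j) ≡ b → (c , at π j) ≼ (c + (if b then 1 else 0) , at π (suc j))
    byActivity true _ = ColLe⇒≼ (c , at π j) (c + 1 , at π (suc j)) (inj₁ (m<m+n c z<s))
    byActivity false inactive = ColLe⇒≼ (c , at π j) (c + 0 , at π (suc j))
      (inj₂ (sym (+-identityʳ c) , inactive⇒descent π j j+1<n inactive))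

η-table : ∀ π → IsPerm π → η π ≡ map (λ v → activeCount π (indexOf v π)) (idn (length π))
η-table π π↭ = begin
  map proj₂ (sortCols (zipWith (λ a b → (b , a)) (υ̃ π) π))  ≡⟨ cong (map proj₂ ∘ sortCols) columns≡ ⟩
  map proj₂ (sortCols (map column π))                       ≡⟨ cong (map proj₂) (sortCols-byPermTop π π↭ label) ⟩
  map proj₂ (map column (idn n))                            ≡⟨ map-∘ (idn n) ⟨
  map label (idn n)                                         ∎
  where
  open ≡-Reasoning
  n = length π
  label : ℕ → ℕ
  label v = activeCount π (indexOf v π)
  column : ℕ → Col
  column v = (v , label v)
  υ̃≡ : υ̃ π ≡ applyUpTo (activeCount π ∘ suc) n
  υ̃≡ = trans (cong (map (activeCount π)) (idn≡applyUpTo n)) (map-applyUpTo suc (activeCount π) n)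
  columns≡ : zipWith (λ a b → (b , a)) (υ̃ π) π ≡ map column π
  columns≡ = begin
    zipWith (λ a b → (b , a)) (υ̃ π) π
      ≡⟨ cong (λ l → zipWith (λ a b → (b , a)) l π) υ̃≡ ⟩
    zipWith (λ a b → (b , a)) (applyUpTo (activeCount π ∘ suc) n) π
      ≡⟨ zipWith-applyUpTo (λ a b → (b , a)) (activeCount π ∘ suc) π ⟩
    applyUpTo (λ j → (at π j , activeCount π (suc j))) n
      ≡⟨ applyUpTo-indexOf π π↭ (λ v k → (v , activeCount π k)) ⟩
    map column π
      ∎

γ∘η : ∀ π → IsPerm π → γ (η π) ≡ π
γ∘η π π↭ = trans (cong γ (η-table π π↭)) (γ-map-idn π π↭ label
  (subst Sorted (applyUpTo-indexOf π π↭ (λ v k → (activeCount π k , v))) (η-columns-sorted π)))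
  where
  label : ℕ → ℕ
  label v = activeCount π (indexOf v π)

-- Standardization

≤-maxW : ∀ l → All (_≤ maxW l) l
≤-maxW l = foldr-forcesᵇ (λ x y x⊔y≤ → m⊔n≤o⇒m≤o x y x⊔y≤ , m⊔n≤o⇒n≤o x y x⊔y≤) 0 l ≤-refl

maxW-≤ : ∀ {l B} → All (_≤ B) l → maxW l ≤ B
maxW-≤ = foldr-preservesᵇ ⊔-lub z≤n

sortedValues : List ℕ → List ℕ
sortedValues s = filter (_∈ℕ? s) (upTo (suc (maxW s)))

sortedValues-increasing : ∀ s → AllPairs _<_ (sortedValues s)
sortedValues-increasing s = AllPairs.filter⁺ (_∈ℕ? s) (AllPairs.applyUpTo⁺₁ id _ (λ i<j _ → i<j))

∈-sortedValues⁺ : ∀ {s v} → v ∈ s → v ∈ sortedValues s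
∈-sortedValues⁺ {s} v∈s = ∈-filter⁺ (_∈ℕ? s) (∈-upTo⁺ (s≤s (All.lookup (≤-maxW s) v∈s))) v∈s

∈-sortedValues⁻ : ∀ {s v} → v ∈ sortedValues s → v ∈ s
∈-sortedValues⁻ {s} v∈ = proj₂ (∈-filter⁻ (_∈ℕ? s) v∈)

rank : List ℕ → ℕ → ℕ
rank d v = length (filter (_<? v) d)

rank-at : ∀ d → AllPairs _<_ d → ∀ {i} → i < length d → rank d (at d i) ≡ i
rank-at (x ∷ d) (x<d ∷ _) {zero} _ = trans (cong length (filter-reject (_<? x) (<-irrefl refl)))
  (cong length (filter-none (_<? x) (All.map (λ x<y y<x → <-asym x<y y<x) x<d)))
rank-at (x ∷ d) (x<d ∷ d!) {suc i} (s<s i<n) =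
  trans (cong length (filter-accept (_<? at d i) (All.lookup x<d (at-∈ d i<n)))) (cong suc (rank-at d d! i<n))

standardize : List ℕ → List ℕ
standardize s = map (λ v → suc (rank (sortedValues s) v)) s

standardize-orderIso : ∀ s → OrderIso s (standardize s)
standardize-orderIso s = orderIso-sym (standardize s) s (map-orderIso mono s ∈-sortedValues⁺)
  where
  d = sortedValues s
  d↗ = sortedValues-increasing s
  mono : StrictlyIncreasingOn (_∈ d) (λ v → suc (rank d v))
  mono a∈ b∈ a<b with ∈⇒at d a∈ | ∈⇒at d b∈
  ... | i , i<n , refl | j , j<n , refl rewrite rank-at d d↗ i<n | rank-at d d↗ j<n =
    s<s (to (strictMono-<⇔ (at-increasing d↗) i<n j<n) a<b)

standardize-isCayley : ∀ s → IsCayley (standardize s)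
standardize-isCayley s = All.map⁺ (All.universal (λ _ → s≤s z≤n) s) , surjective
  where
  d = sortedValues s
  d↗ = sortedValues-increasing s
  rank-bounded : ∀ {v} → v ∈ s → suc (rank d v) ≤ length d
  rank-bounded v∈s with ∈⇒at d (∈-sortedValues⁺ v∈s)
  ... | i , i<n , refl rewrite rank-at d d↗ i<n = i<n
  surjective : ∀ k → 1 ≤ k → k ≤ maxW (standardize s) → k ∈ standardize s
  surjective (suc i) _ k≤ = subst (_∈ standardize s) (cong suc (rank-at d d↗ i<n))
    (∈-map⁺ (λ v → suc (rank d v)) (∈-sortedValues⁻ (at-∈ d i<n)))
    where
    i<n : i < length d
    i<n = ≤-trans k≤ (maxW-≤ (All.map⁺ (All.tabulate rank-bounded)))

-- γ transports pattern containment

∈-columns⁻ : ∀ {p} x → p ∈ columns x → ∃ λ i → i < length x × p ≡ (at x i , suc i)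
∈-columns⁻ x p∈ = ∈-applyUpTo⁻ _ (subst (_ ∈_) (columns-applyUpTo x) p∈)

γ-orderIso : ∀ s z → OrderIso s z → γ s ≡ γ z
γ-orderIso s z (s≡z , iso) = begin
  map proj₂ (sortCols (columns s))          ≡⟨ map-∘ {g = proj₂} {f = retop} (sortCols (columns s)) ⟩
  map proj₂ (map retop (sortCols (columns s))) ≡⟨ cong (map proj₂) (sortCols-map retop (columns s) preserves) ⟨
  map proj₂ (sortCols (map retop (columns s))) ≡⟨ cong (map proj₂ ∘ sortCols) columns≡ ⟩
  map proj₂ (sortCols (columns z))          ∎
  where
  open ≡-Reasoning
  retop : Col → Col
  retop (_ , i) = (at z (i ∸ 1) , i)
  columns≡ : map retop (columns s) ≡ columns z
  columns≡ = begin
    map retop (columns s)                              ≡⟨ cong (map retop) (columns-applyUpTo s) ⟩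
    map retop (applyUpTo (λ i → (at s i , suc i)) (length s)) ≡⟨ map-applyUpTo _ retop (length s) ⟩
    applyUpTo (λ i → (at z i , suc i)) (length s)      ≡⟨ cong (applyUpTo _) s≡z ⟩
    applyUpTo (λ i → (at z i , suc i)) (length z)      ≡⟨ columns-applyUpTo z ⟨
    columns z                                          ∎
  preserves : ∀ {p q} → p ∈ columns s → q ∈ columns s → colLe (retop p) (retop q) ≡ colLe p q
  preserves p∈ q∈ with ∈-columns⁻ s p∈ | ∈-columns⁻ s q∈
  ... | i , i<n , refl | j , j<n , refl =
    colLe-cong {a = at z i} {suc i} {at z j} {suc j} {at s i} {suc i} {at s j} {suc j}
      (⇔.sym (proj₁ (iso i j i<n j<n))) (⇔.sym (proj₂ (iso i j i<n j<n))) ⇔.refl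

unzip-applyUpTo : ∀ (E : List Col) → applyUpTo (λ i → (at (map proj₁ E) i , at (map proj₂ E) i)) (length E) ≡ E
unzip-applyUpTo [] = refl
unzip-applyUpTo (e ∷ E) = cong (e ∷_) (unzip-applyUpTo E)

columns-rebottom : ∀ (E : List Col) →
  map (λ (a , i) → (a , at (map proj₂ E) (i ∸ 1))) (columns (map proj₁ E)) ≡ E
columns-rebottom E = begin
  map rebottom (columns s)                                     ≡⟨ cong (map rebottom) (columns-applyUpTo s) ⟩
  map rebottom (applyUpTo (λ i → (at s i , suc i)) (length s)) ≡⟨ map-applyUpTo _ rebottom (length s) ⟩
  applyUpTo (λ i → (at s i , at P i)) (length s)               ≡⟨ cong (applyUpTo _) (length-map proj₁ E) ⟩
  applyUpTo (λ i → (at s i , at P i)) (length E)               ≡⟨ unzip-applyUpTo E ⟩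
  E                                                            ∎
  where
  open ≡-Reasoning
  s = map proj₁ E
  P = map proj₂ E
  rebottom : Col → Col
  rebottom (a , i) = (a , at P (i ∸ 1))

-- Replacing the bottoms 1, …, k of the columns of s by increasing positions commutes with sorting.
sortCols-bottoms : ∀ E → AllPairs _<_ (map proj₂ E) →
  map proj₂ (sortCols E) ≡ map (λ a → at (map proj₂ E) (a ∸ 1)) (γ (map proj₁ E))
sortCols-bottoms E increasing = begin
  map proj₂ (sortCols E)                         ≡⟨ cong (map proj₂ ∘ sortCols) (columns-rebottom E) ⟨
  map proj₂ (sortCols (map rebottom (columns s))) ≡⟨ cong (map proj₂) (sortCols-map rebottom (columns s) preserves) ⟩
  map proj₂ (map rebottom (sortCols (columns s))) ≡⟨ map-∘ {g = proj₂} {f = rebottom} (sortCols (columns s)) ⟨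
  map (relabel ∘ proj₂) (sortCols (columns s))   ≡⟨ map-∘ (sortCols (columns s)) ⟩
  map relabel (γ s)                              ∎
  where
  open ≡-Reasoning
  s = map proj₁ E
  P = map proj₂ E
  relabel : ℕ → ℕ
  relabel a = at P (a ∸ 1)
  rebottom : Col → Col
  rebottom (a , i) = (a , relabel i)
  index< : ∀ {i} → i < length s → i < length P
  index< = subst (_ <_) (trans (length-map proj₁ E) (sym (length-map proj₂ E)))
  preserves : ∀ {p q} → p ∈ columns s → q ∈ columns s → colLe (rebottom p) (rebottom q) ≡ colLe p q
  preserves p∈ q∈ with ∈-columns⁻ s p∈ | ∈-columns⁻ s q∈
  ... | i , i<n , refl | j , j<n , refl = colLe-cong {a = at s i} {c = at s j} ⇔.refl ⇔.refl
    (⇔.trans (strictMono-≤⇔ (at-increasing increasing) (index< j<n) (index< i<n)) (mk⇔ s≤s s≤s⁻¹))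

sortCols-relabel : ∀ E → AllPairs _<_ (map proj₂ E) → OrderIso (map proj₂ (sortCols E)) (γ (map proj₁ E))
sortCols-relabel E increasing =
  subst (λ t → OrderIso t (γ s)) (sym (sortCols-bottoms E increasing)) (map-orderIso relabel-mono (γ s) inRange)
  where
  s = map proj₁ E
  P = map proj₂ E
  IsPosition : ℕ → Set
  IsPosition a = ∃ λ i → i < length P × a ≡ suc i
  relabel-mono : StrictlyIncreasingOn IsPosition (λ a → at P (a ∸ 1))
  relabel-mono (i , i<k , refl) (j , j<k , refl) (s<s i<j) = at-increasing increasing i<k j<k i<j
  inRange : ∀ {a} → a ∈ γ s → IsPosition a
  inRange a∈ = let (i , i<n , a≡) = ∈-idn⁻ (length s) (∈-resp-↭ (γ-↭-idn s) a∈)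
    in i , subst (i <_) (trans (length-map proj₁ E) (sym (length-map proj₂ E))) i<n , a≡

columns-sublist-increasing : ∀ {E} x → E ⊆ columns x → AllPairs _<_ (map proj₂ E)
columns-sublist-increasing x E⊆ =
  AllPairs-⊆ (⊆-map⁺ proj₂ E⊆) (subst (AllPairs _<_) (sym (map-proj₂-columns x)) (idn-increasing (length x)))

γ-preserves-containment : ∀ x z → Contains x z → Contains (γ x) (γ z)
γ-preserves-containment x z (s , s⊆x , s≅z) with ⊆-map-lift proj₁ (subst (s ⊆_) (sym (map-proj₁-columns x)) s⊆x)
... | E , E⊆ , refl = map proj₂ (sortCols E) , ⊆-map⁺ proj₂ (sortCols-⊆ (columns-unique x) E⊆) ,
  subst (OrderIso (map proj₂ (sortCols E))) (γ-orderIso s z s≅z) (sortCols-relabel E (columns-sublist-increasing x E⊆))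

γ-reflects-containment : ∀ x y → Contains (γ x) (γ y) → ∃ λ z → InClass y z × Contains x z
γ-reflects-containment x y (t , t⊆γx , t≅γy) with ⊆-map-lift proj₂ t⊆γx
... | T , T⊆ , refl =
  standardize s , (standardize-isCayley s , γz≡γy) , s , s⊆x , standardize-orderIso s
  where
  E = filter (_∈? T) (columns x)
  E⊆ : E ⊆ columns x
  E⊆ = filter-⊆ (_∈? T) (columns x)
  s = map proj₁ E
  s⊆x : s ⊆ x
  s⊆x = subst (s ⊆_) (map-proj₁-columns x) (⊆-map⁺ proj₁ E⊆)
  t≅γs : OrderIso (map proj₂ T) (γ s)
  t≅γs = subst (λ T′ → OrderIso (map proj₂ T′) (γ s)) (sortCols-filter-sublist (columns-unique x) T⊆)
    (sortCols-relabel E (columns-sublist-increasing x E⊆))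
  γs≡γy : γ s ≡ γ y
  γs≡γy = γ-injective (γ-isPerm s) (γ-isPerm y)
    (trans (sym (γ-orderIso (map proj₂ T) (γ s) t≅γs)) (γ-orderIso (map proj₂ T) (γ y) t≅γy))
  γz≡γy : γ (standardize s) ≡ γ y
  γz≡γy = trans (sym (γ-orderIso s (standardize s) (standardize-orderIso s))) γs≡γy

γ[XAvoid]⇔SAvoid : ∀ y π → InImageγ (InXAvoid y) π ⇔ InSAvoid (γ y) π
γ[XAvoid]⇔SAvoid y π = mk⇔ image⇒avoider avoider⇒image
  where
  image⇒avoider : InImageγ (InXAvoid y) π → InSAvoid (γ y) π
  image⇒avoider (x , (_ , x-avoids) , refl) = γ-isPerm x , λ γx-contains →
    let (z , z∈[y] , x-contains) = γ-reflects-containment x y γx-contains in x-avoids z z∈[y] x-contains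
  avoider⇒image : InSAvoid (γ y) π → InImageγ (InXAvoid y) π
  avoider⇒image (π↭ , π-avoids) = η π , ((π , π↭ , refl) , η-avoids) , γ∘η π π↭
    where
    η-avoids : ∀ z → InClass y z → Avoids (η π) z
    η-avoids z (_ , γz≡γy) ηπ-contains =
      π-avoids (subst₂ Contains (γ∘η π π↭) γz≡γy (γ-preserves-containment (η π) z ηπ-contains))

mainTheorem5 :
    (∀ π → IsPerm π → InX (η π) × γ (η π) ≡ π)
    × (∀ x → InX x → IsPerm (γ x) × η (γ x) ≡ x)
    × (∀ σ → IsPerm σ → ∀ π → InSAvoid σ π ⇔ InImageγ (InXAvoid (inv σ)) π)
    × (∀ y → IsCayley y → ∀ π → InImageγ (InXAvoid y) π ⇔ InSAvoid (γ y) π)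
mainTheorem5 =
    (λ π π↭ → (π , π↭ , refl) , γ∘η π π↭)
  , (λ { x (π , π↭ , refl) → γ-isPerm (η π) , cong η (γ∘η π π↭) })
  , (λ σ σ↭ π → subst (λ τ → InSAvoid τ π ⇔ InImageγ (InXAvoid (inv σ)) π) (γ-inv σ σ↭)
                       (⇔.sym (γ[XAvoid]⇔SAvoid (inv σ) π)))
  , (λ y _ → γ[XAvoid]⇔SAvoid y)
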